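{- Let $G_1$ and $G_2$ be graphs on $n\ge 4$ vertices with the same reduced deck. Then: (a) $G_1$ and $G_2$ have the same minimum degree and the same maximum degree; (b) for each $3\le k<n$, either both or neither of $G_1,G_2$ contain a $k$-cycle; (c) either both or neither of $G_1,G_2$ are bipartite.
   Context: Graphs are finite, simple and undirected. For a vertex $v$ of $G$, the card $G-v$ is the unlabelled graph obtained by deleting $v$. The reduced deck of $G$ is the set (not multiset) of isomorphism types of the cards of $G$. -}

module Defs where

open import Data.Nat using (ℕ; zero; suc; _+_; _⊓_; _⊔_; _≤_)
open import Data.Bool using (Bool; true; false; if_then_else_)
open import Data.Fin using (Fin; toℕ; punchIn)
open import Data.List using (List; map; foldr; allFin)
open import Data.Nat.ListAction using (sum)
open import Data.Product using (Σ; ∃; _×_)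
open import Data.Sum using (_⊎_)
open import Relation.Binary.PropositionalEquality using (_≡_; _≢_)
open import Function.Bundles using (_↔_; Inverse)
open import Function.Definitions using (Injective)

record Graph (n : ℕ) : Set where
  field
    adj   : Fin n → Fin n → Bool
    sym   : ∀ u v → adj u v ≡ adj v u
    irrfl : ∀ v → adj v v ≡ false
open Graph public

_≅_ : ∀ {n m} → Graph n → Graph m → Set
_≅_ {n} {m} G H =
  Σ (Fin n ↔ Fin m) λ e →
    ∀ u v → adj G u v ≡ adj H (Inverse.to e u) (Inverse.to e v)

card : ∀ {m} → Graph (suc m) → Fin (suc m) → Graph m
card G v = record
  { adj   = λ a b → adj G (punchIn v a) (punchIn v b)
  ; sym   = λ a b → sym G (punchIn v a) (punchIn v b)
  ; irrfl = λ a → irrfl G (punchIn v a)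
  }

-- Same reduced deck: the *sets* of isomorphism types of cards coincide.
SameReducedDeck : ∀ {m} → Graph (suc m) → Graph (suc m) → Set
SameReducedDeck G H =
  (∀ v → ∃ λ w → card G v ≅ card H w) × (∀ w → ∃ λ v → card H w ≅ card G v)

deg : ∀ {n} → Graph n → Fin n → ℕ
deg {n} G v = sum (map (λ w → if adj G v w then 1 else 0) (allFin n))

minDeg : ∀ {m} → Graph (suc m) → ℕ
minDeg {m} G = foldr _⊓_ (deg G Fin.zero) (map (deg G) (allFin (suc m)))

maxDeg : ∀ {m} → Graph (suc m) → ℕ
maxDeg {m} G = foldr _⊔_ 0 (map (deg G) (allFin (suc m)))

CycStep : (k : ℕ) → Fin k → Fin k → Set
CycStep k i j = (suc (toℕ i) ≡ toℕ j) ⊎ ((suc (toℕ i) ≡ k) × (toℕ j ≡ 0))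

HasCycle : ∀ {n} → Graph n → ℕ → Set
HasCycle {n} G k =
  Σ (Fin k → Fin n) λ f →
    Injective _≡_ _≡_ f × (∀ i j → CycStep k i j → adj G (f i) (f j) ≡ true)

Bipartite : ∀ {n} → Graph n → Set
Bipartite {n} G =
  Σ (Fin n → Bool) λ c → ∀ u v → adj G u v ≡ true → c u ≢ c v

module Submission where

-- Deleting v lowers the degree sum by 2·deg v, so matching cards G - v ≅ H - w give
-- degreeSum G + 2·deg H w = degreeSum H + 2·deg G v. Comparing the cards that delete a vertex of
-- minimum, resp. maximum, degree yields δ₁ + Δ₂ = δ₂ + Δ₁. If δ₁ < δ₂, a minimum-degree vertex v of
-- G₁ is isolated (deleting a neighbour of it would produce a card forcing δ₂ ≤ δ₁) and dually a
-- maximum-degree vertex w of G₂ is dominating. Every card of G₁ avoiding v then matches G₂ - w,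
-- which forces δ₂ = 1 and Δ₁ = n - 2, so such a card is edgeless although it has vertices of
-- degree at least n - 3 ≥ 1.
--
-- A k-cycle with k < n misses a vertex v and so lies in the card G - v.
--
-- A graph is bipartite or has an odd closed walk. If G₂ is bipartite, a shortest odd closed walk
-- of G₁ cannot miss a vertex (it would lie in a card and map into G₂); being shortest it does not
-- repeat its start a, has no chords and forces minimum degree 2. So G₁ - a ≅ G₂ - b contains a
-- spanning path whose ends have degree at most 1, and since δ(G₂) = δ(G₁) ≥ 2 both ends are
-- adjacent to b in G₂, closing an odd cycle there.

open import Defs
open import Data.Nat using (ℕ; zero; suc; _+_; _*_; _≤_; _<_; z≤n; s≤s; parity)
import Data.Nat.Properties as ℕ
open import Data.Nat.Solver using (module +-*-Solver)
open import Data.Nat.ListAction using () renaming (sum to listSum)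
open import Data.Parity using (Parity; 0ℙ; 1ℙ) renaming (_+_ to _⊕_)
import Data.Parity.Properties as Parity
open import Data.Bool using (Bool; true; false; if_then_else_)
import Data.Bool.Properties as Bool
open import Data.Fin using (Fin; zero; suc; punchIn; punchOut)
import Data.Fin.Properties as Fin
open import Data.Fin.Properties
  using (punchIn-injective; punchInᵢ≢i; punchIn-punchOut; ¬∀⟶∃¬; any?; all?)
open import Data.List using (List; []; _∷_; _++_; _∷ʳ_; length; map; tabulate; allFin; initLast; _∷ʳ′_)
import Data.List.Properties as List
open import Data.List.Properties using (foldr-preservesᵒ)
open import Data.List.Membership.Propositional using (_∈_; _∉_)
open import Data.List.Membership.Propositional.Properties
  using (foldr-selective; ∈-map⁺; ∈-map⁻; ∈-allFin; ∈-∃++; ∈-++⁻; ∈-++⁺ˡ; ∈-++⁺ʳ)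
import Data.List.Relation.Unary.Any as Any
open import Data.List.Relation.Unary.Any using (here; there)
open import Algebra.Properties.CommutativeMonoid.Sum ℕ.+-0-commutativeMonoid
  using (sum; sum-remove; sum-permute; ∑-distrib-+; sum-cong-≗)
open import Data.Product using (Σ; ∃; _×_; _,_; proj₁; proj₂; map₁; swap)
open import Data.Sum using (_⊎_; inj₁; inj₂; [_,_])
open import Data.Empty using (⊥; ⊥-elim)
open import Relation.Nullary using (¬_; Dec; yes; no; ¬?; _×-dec_)
open import Relation.Binary using (tri<; tri≈; tri>)
open import Relation.Binary.PropositionalEquality
  using (_≡_; _≢_; refl; trans; cong; cong₂; subst; subst₂; module ≡-Reasoning)
import Relation.Binary.PropositionalEquality as ≡
open import Function.Bundles using (Inverse; Injection; _⇔_; mk⇔)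
open import Function.Definitions using (Injective)
open import Function.Properties.Inverse using (↔⇒↣)

-- Degrees

indicator : Bool → ℕ
indicator true  = 1
indicator false = 0

indicator≤1 : ∀ b → indicator b ≤ 1
indicator≤1 true  = s≤s z≤n
indicator≤1 false = z≤n

sum≤size : ∀ {n} (f : Fin n → ℕ) → (∀ i → f i ≤ 1) → sum f ≤ n
sum≤size {zero}  f f≤1 = z≤n
sum≤size {suc n} f f≤1 = ℕ.+-mono-≤ (f≤1 zero) (sum≤size (λ i → f (suc i)) (λ i → f≤1 (suc i)))

sum<size : ∀ {n} (f : Fin n → ℕ) → (∀ i → f i ≤ 1) → ∀ i → f i ≡ 0 → sum f < n
sum<size {suc n} f f≤1 i fi≡0 = begin-strict
  sum f                          ≡⟨ sum-remove {i = i} f ⟩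
  f i + sum (λ j → f (punchIn i j)) ≡⟨ cong (_+ sum (λ j → f (punchIn i j))) fi≡0 ⟩
  sum (λ j → f (punchIn i j))    ≤⟨ sum≤size _ (λ j → f≤1 (punchIn i j)) ⟩
  n                              <⟨ ℕ.n<1+n n ⟩
  suc n                          ∎
  where open ℕ.≤-Reasoning

sum-const-1 : ∀ {n} (f : Fin n → ℕ) → (∀ i → f i ≡ 1) → sum f ≡ n
sum-const-1 {zero}  f f≡1 = refl
sum-const-1 {suc n} f f≡1 = cong₂ _+_ (f≡1 zero) (sum-const-1 (λ i → f (suc i)) (λ i → f≡1 (suc i)))

sum-zero : ∀ {n} (f : Fin n → ℕ) → (∀ i → f i ≡ 0) → sum f ≡ 0
sum-zero {zero}  f f≡0 = refl
sum-zero {suc n} f f≡0 = cong₂ _+_ (f≡0 zero) (sum-zero (λ i → f (suc i)) (λ i → f≡0 (suc i)))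

term≤sum : ∀ {n} (f : Fin n → ℕ) i → f i ≤ sum f
term≤sum f zero    = ℕ.m≤m+n _ _
term≤sum f (suc i) = ℕ.≤-trans (term≤sum (λ j → f (suc j)) i) (ℕ.m≤n+m _ _)

adj-sym : ∀ {n} (G : Graph n) {u v} → adj G u v ≡ true → adj G v u ≡ true
adj-sym G {u} {v} e = trans (sym G v u) e

adj-irrefl : ∀ {n} (G : Graph n) {v} → adj G v v ≢ true
adj-irrefl G {v} e with trans (≡.sym (irrfl G v)) e
... | ()

deg-∑ : ∀ {n} (G : Graph n) v → deg G v ≡ sum (λ w → indicator (adj G v w))
deg-∑ {n} G v = trans (listSum-tabulate (λ w → if adj G v w then 1 else 0) (λ i → i))
                      (sum-cong-≗ (λ w → if≡indicator (adj G v w)))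
  where
  listSum-tabulate : ∀ {k} {A : Set} (f : A → ℕ) (g : Fin k → A) →
                     listSum (map f (tabulate g)) ≡ sum (λ i → f (g i))
  listSum-tabulate {zero}  f g = refl
  listSum-tabulate {suc k} f g = cong (f (g zero) +_) (listSum-tabulate f (λ i → g (suc i)))
  if≡indicator : ∀ b → (if b then 1 else 0) ≡ indicator b
  if≡indicator true  = refl
  if≡indicator false = refl

deg-punchIn : ∀ {m} (G : Graph (suc m)) v x →
              deg G (punchIn v x) ≡ indicator (adj G (punchIn v x) v) + deg (card G v) x
deg-punchIn G v x = begin
  deg G (punchIn v x)                                   ≡⟨ deg-∑ G _ ⟩
  sum (λ w → indicator (adj G (punchIn v x) w))
    ≡⟨ sum-remove {i = v} (λ w → indicator (adj G (punchIn v x) w)) ⟩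
  indicator (adj G (punchIn v x) v) + sum (λ y → indicator (adj (card G v) x y))
    ≡⟨ cong (indicator (adj G (punchIn v x) v) +_) (≡.sym (deg-∑ (card G v) x)) ⟩
  indicator (adj G (punchIn v x) v) + deg (card G v) x ∎
  where open ≡-Reasoning

deg-others : ∀ {m} (G : Graph (suc m)) v → deg G v ≡ sum (λ x → indicator (adj G v (punchIn v x)))
deg-others G v = begin
  deg G v                                                   ≡⟨ deg-∑ G v ⟩
  sum (λ w → indicator (adj G v w))
    ≡⟨ sum-remove {i = v} (λ w → indicator (adj G v w)) ⟩
  indicator (adj G v v) + sum (λ x → indicator (adj G v (punchIn v x)))
    ≡⟨ cong (λ b → indicator b + sum (λ x → indicator (adj G v (punchIn v x)))) (irrfl G v) ⟩
  sum (λ x → indicator (adj G v (punchIn v x)))             ∎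
  where open ≡-Reasoning

deg≤ : ∀ {m} (G : Graph (suc m)) v → deg G v ≤ m
deg≤ {m} G v = subst (_≤ m) (≡.sym (deg-others G v)) (sum≤size _ (λ x → indicator≤1 _))

deg-card≤deg : ∀ {m} (G : Graph (suc m)) v x → deg (card G v) x ≤ deg G (punchIn v x)
deg-card≤deg G v x = subst (deg (card G v) x ≤_) (≡.sym (deg-punchIn G v x)) (ℕ.m≤n+m _ _)

deg≤suc-deg-card : ∀ {m} (G : Graph (suc m)) v x → deg G (punchIn v x) ≤ suc (deg (card G v) x)
deg≤suc-deg-card G v x =
  subst (_≤ suc (deg (card G v) x)) (≡.sym (deg-punchIn G v x)) (ℕ.+-monoˡ-≤ _ (indicator≤1 _))

deg-punchIn-adj : ∀ {m} (G : Graph (suc m)) v x → adj G (punchIn v x) v ≡ true →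
                  deg G (punchIn v x) ≡ suc (deg (card G v) x)
deg-punchIn-adj G v x e = trans (deg-punchIn G v x) (cong (λ b → indicator b + deg (card G v) x) e)

deg-punchIn-nonadj : ∀ {m} (G : Graph (suc m)) v x → adj G (punchIn v x) v ≡ false →
                     deg G (punchIn v x) ≡ deg (card G v) x
deg-punchIn-nonadj G v x e = trans (deg-punchIn G v x) (cong (λ b → indicator b + deg (card G v) x) e)

deg-≅ : ∀ {n m} {G : Graph n} {H : Graph m} (iso : G ≅ H) u → deg G u ≡ deg H (Inverse.to (proj₁ iso) u)
deg-≅ {n} {m} {G} {H} (e , adj≡) u = begin
  deg G u                                              ≡⟨ deg-∑ G u ⟩
  sum (λ a → indicator (adj G u a))                    ≡⟨ sum-cong-≗ (λ a → cong indicator (adj≡ u a)) ⟩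
  sum (λ a → indicator (adj H (to u) (to a)))          ≡⟨ ≡.sym (sum-permute _ e) ⟩
  sum (λ b → indicator (adj H (to u) b))               ≡⟨ ≡.sym (deg-∑ H (to u)) ⟩
  deg H (to u)                                         ∎
  where
  open ≡-Reasoning
  to : Fin n → Fin m
  to = Inverse.to e

neighbour-or-isolated : ∀ {n} (G : Graph n) v → (∃ λ u → adj G v u ≡ true) ⊎ deg G v ≡ 0
neighbour-or-isolated G v with any? (λ u → adj G v u Bool.≟ true)
... | yes neighbour = inj₁ neighbour
... | no ¬neighbour = inj₂ (trans (deg-∑ G v)
        (sum-zero _ (λ u → cong indicator (Bool.¬-not (λ e → ¬neighbour (u , e))))))

non-neighbour-or-dominating : ∀ {m} (G : Graph (suc m)) v →
                              (∃ λ u → u ≢ v × adj G v u ≡ false) ⊎ deg G v ≡ m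
non-neighbour-or-dominating {m} G v with all? (λ x → adj G v (punchIn v x) Bool.≟ true)
... | yes all = inj₂ (trans (deg-others G v) (sum-const-1 _ (λ x → cong indicator (all x))))
... | no ¬all with ¬∀⟶∃¬ m _ (λ x → adj G v (punchIn v x) Bool.≟ true) ¬all
...   | x , ¬adj = inj₁ (punchIn v x , punchInᵢ≢i v x , Bool.¬-not ¬adj)

dominating : ∀ {m} (G : Graph (suc m)) v → deg G v ≡ m → ∀ u → u ≢ v → adj G v u ≡ true
dominating {m} G v deg≡m u u≢v with adj G v u in e
... | true  = refl
... | false = ⊥-elim (ℕ.<-irrefl deg≡m (subst (_< m) (≡.sym (deg-others G v))
                (sum<size _ (λ _ → indicator≤1 _) (punchOut v≢u) u-absent)))
  where
  v≢u : v ≢ u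
  v≢u eq = u≢v (≡.sym eq)
  u-absent : indicator (adj G v (punchIn v (punchOut v≢u))) ≡ 0
  u-absent = cong indicator (trans (cong (adj G v) (punchIn-punchOut v≢u)) e)

two≤deg : ∀ {n} (G : Graph n) {u x y} → x ≢ y → adj G u x ≡ true → adj G u y ≡ true → 2 ≤ deg G u
two≤deg {suc m} G {u} {x} {y} x≢y u∼x u∼y = begin
  2
    ≡⟨ cong₂ _+_ (cong indicator (≡.sym u∼x)) (cong indicator (≡.sym u∼y′)) ⟩
  f x + f (punchIn x y′)                  ≤⟨ ℕ.+-monoʳ-≤ (f x) (term≤sum (λ z → f (punchIn x z)) y′) ⟩
  f x + sum (λ z → f (punchIn x z))       ≡⟨ ≡.sym (sum-remove {i = x} f) ⟩
  sum f                                   ≡⟨ ≡.sym (deg-∑ G u) ⟩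
  deg G u                                 ∎
  where
  open ℕ.≤-Reasoning
  f : Fin (suc m) → ℕ
  f z = indicator (adj G u z)
  y′ : Fin m
  y′ = punchOut x≢y
  u∼y′ : adj G u (punchIn x y′) ≡ true
  u∼y′ = trans (cong (adj G u) (punchIn-punchOut x≢y)) u∼y

deg≤1 : ∀ {n} (G : Graph n) {u s} → (∀ v → adj G u v ≡ true → v ≡ s) → deg G u ≤ 1
deg≤1 {suc m} G {u} {s} only-s = begin
  deg G u                                 ≡⟨ deg-∑ G u ⟩
  sum f                                   ≡⟨ sum-remove {i = s} f ⟩
  f s + sum (λ z → f (punchIn s z))       ≡⟨ cong (f s +_) (sum-zero _ others-absent) ⟩
  f s + 0                                 ≤⟨ ℕ.+-monoˡ-≤ 0 (indicator≤1 _) ⟩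
  1                                       ∎
  where
  open ℕ.≤-Reasoning
  f : Fin (suc m) → ℕ
  f z = indicator (adj G u z)
  others-absent : ∀ z → f (punchIn s z) ≡ 0
  others-absent z with adj G u (punchIn s z) in e
  ... | false = refl
  ... | true  = ⊥-elim (punchInᵢ≢i s z (only-s _ e))

deg-card≤1 : ∀ {m} (G : Graph (suc m)) v {x s} (v≢x : v ≢ x) → s ≢ v →
             (∀ {u} → adj G x u ≡ true → u ≢ v → u ≡ s) → deg (card G v) (punchOut v≢x) ≤ 1
deg-card≤1 G v {x} {s} v≢x s≢v only-s = deg≤1 (card G v) {s = punchOut v≢s} λ y x∼y →
  punchIn-injective v _ _ (trans (only-s (subst (λ z → adj G z (punchIn v y) ≡ true) (punchIn-punchOut v≢x) x∼y)
                                         (punchInᵢ≢i v y))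
                                 (≡.sym (punchIn-punchOut v≢s)))
  where
  v≢s : v ≢ s
  v≢s v≡s = s≢v (≡.sym v≡s)

isolated-card : ∀ {m} (G : Graph (suc m)) {v z} → deg G v ≡ 0 → (z≢v : z ≢ v) →
                deg (card G z) (punchOut z≢v) ≡ 0
isolated-card G {v} {z} v-isolated z≢v =
  ℕ.n≤0⇒n≡0 (subst (deg (card G z) (punchOut z≢v) ≤_)
                   (trans (cong (deg G) (punchIn-punchOut z≢v)) v-isolated)
                   (deg-card≤deg G z (punchOut z≢v)))

dominating-card : ∀ {k} (G : Graph (suc (suc k))) {v z} → deg G v ≡ suc k → (z≢v : z ≢ v) →
                  deg (card G z) (punchOut z≢v) ≡ k
dominating-card G {v} {z} v-dominating z≢v = ℕ.suc-injective (begin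
  suc (deg (card G z) (punchOut z≢v)) ≡⟨ ≡.sym (deg-punchIn-adj G z _ v∼z) ⟩
  deg G (punchIn z (punchOut z≢v))    ≡⟨ cong (deg G) (punchIn-punchOut z≢v) ⟩
  deg G v                             ≡⟨ v-dominating ⟩
  suc _                               ∎)
  where
  open ≡-Reasoning
  v∼z : adj G (punchIn z (punchOut z≢v)) z ≡ true
  v∼z = subst (λ u → adj G u z ≡ true) (≡.sym (punchIn-punchOut z≢v))
              (dominating G v v-dominating z z≢v)

¬isolated∧dominating : ∀ {k} (G : Graph (suc (suc k))) x y → deg G x ≡ 0 → deg G y ≡ suc k → ⊥
¬isolated∧dominating G x y x-isolated y-dominating = ℕ.<⇒≱ (s≤s z≤n) (begin
  1                                 ≡⟨ cong indicator (≡.sym x∼y) ⟩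
  indicator (adj G x y)             ≤⟨ term≤sum (λ u → indicator (adj G x u)) y ⟩
  sum (λ u → indicator (adj G x u)) ≡⟨ ≡.sym (deg-∑ G x) ⟩
  deg G x                           ≡⟨ x-isolated ⟩
  0                                 ∎)
  where
  open ℕ.≤-Reasoning
  x≢y : x ≢ y
  x≢y refl with trans (≡.sym x-isolated) y-dominating
  ... | ()
  x∼y : adj G x y ≡ true
  x∼y = adj-sym G (dominating G y y-dominating x x≢y)

degreeSum : ∀ {n} → Graph n → ℕ
degreeSum G = sum (deg G)

degreeSum-≅ : ∀ {n} {G H : Graph n} → G ≅ H → degreeSum G ≡ degreeSum H
degreeSum-≅ {G = G} {H} iso =
  trans (sum-cong-≗ (deg-≅ {G = G} {H} iso)) (≡.sym (sum-permute (deg H) (proj₁ iso)))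

degreeSum-card : ∀ {m} (G : Graph (suc m)) v → degreeSum G ≡ degreeSum (card G v) + 2 * deg G v
degreeSum-card G v = begin
  degreeSum G                                                  ≡⟨ sum-remove {i = v} (deg G) ⟩
  deg G v + sum (λ x → deg G (punchIn v x))
    ≡⟨ cong (deg G v +_) (sum-cong-≗ (deg-punchIn G v)) ⟩
  deg G v + sum (λ x → edge-to-v x + deg (card G v) x)
    ≡⟨ cong (deg G v +_) (∑-distrib-+ edge-to-v (deg (card G v))) ⟩
  deg G v + (sum edge-to-v + degreeSum (card G v))
    ≡⟨ cong (λ k → deg G v + (k + degreeSum (card G v))) edges-at-v ⟩
  deg G v + (deg G v + degreeSum (card G v))
    ≡⟨ solve 2 (λ d s → d :+ (d :+ s) := s :+ con 2 :* d) refl (deg G v) _ ⟩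
  degreeSum (card G v) + 2 * deg G v                           ∎
  where
  open ≡-Reasoning
  open +-*-Solver
  edge-to-v : Fin _ → ℕ
  edge-to-v x = indicator (adj G (punchIn v x) v)
  edges-at-v : sum edge-to-v ≡ deg G v
  edges-at-v = trans (sum-cong-≗ (λ x → cong indicator (sym G (punchIn v x) v))) (≡.sym (deg-others G v))

minDeg≤deg : ∀ {m} (G : Graph (suc m)) v → minDeg G ≤ deg G v
minDeg≤deg G v = foldr-preservesᵒ (λ x y → [ ℕ.m≤n⇒m⊓o≤n y , ℕ.m≤n⇒o⊓m≤n x ]) _ _
  (inj₂ (Any.map (λ e → ℕ.≤-reflexive (≡.sym e)) (∈-map⁺ (deg G) (∈-allFin v))))

deg≤maxDeg : ∀ {m} (G : Graph (suc m)) v → deg G v ≤ maxDeg G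
deg≤maxDeg G v = foldr-preservesᵒ (λ x y → [ ℕ.m≤n⇒m≤n⊔o y , ℕ.m≤n⇒m≤o⊔n x ]) _ _
  (inj₂ (Any.map ℕ.≤-reflexive (∈-map⁺ (deg G) (∈-allFin v))))

minDeg-attained : ∀ {m} (G : Graph (suc m)) → ∃ λ v → minDeg G ≡ deg G v
minDeg-attained G with foldr-selective ℕ.⊓-sel (deg G zero) (map (deg G) (allFin _))
... | inj₁ min≡ = zero , min≡
... | inj₂ min∈ with ∈-map⁻ (deg G) min∈
...   | v , _ , min≡ = v , min≡

maxDeg-attained : ∀ {m} (G : Graph (suc m)) → ∃ λ v → maxDeg G ≡ deg G v
maxDeg-attained G with foldr-selective ℕ.⊔-sel 0 (map (deg G) (allFin _))
... | inj₁ max≡0 = zero , ℕ.≤-antisym (subst (_≤ deg G zero) (≡.sym max≡0) z≤n) (deg≤maxDeg G zero)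
... | inj₂ max∈ with ∈-map⁻ (deg G) max∈
...   | v , _ , max≡ = v , max≡

maxDeg≤ : ∀ {m} (G : Graph (suc m)) → maxDeg G ≤ m
maxDeg≤ G with maxDeg-attained G
... | v , max≡ = subst (_≤ _) (≡.sym max≡) (deg≤ G v)

adjacent-to-deleted : ∀ {m} (H : Graph (suc m)) v y → deg (card H v) y ≤ 1 → 2 ≤ minDeg H →
                      adj H (punchIn v y) v ≡ true
adjacent-to-deleted H v y deg≤1′ 2≤minDeg with adj H (punchIn v y) v in e
... | true  = refl
... | false = ⊥-elim (ℕ.<⇒≱ (s≤s (s≤s z≤n)) (begin
  2                        ≤⟨ 2≤minDeg ⟩
  minDeg H                 ≤⟨ minDeg≤deg H (punchIn v y) ⟩
  deg H (punchIn v y)      ≡⟨ deg-punchIn-nonadj H v y e ⟩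
  deg (card H v) y         ≤⟨ deg≤1′ ⟩
  1                        ∎))
  where open ℕ.≤-Reasoning

-- Minimum and maximum degree

DeckIncluded : ∀ {m} → Graph (suc m) → Graph (suc m) → Set
DeckIncluded G H = ∀ v → ∃ λ w → card G v ≅ card H w

degreeSum-cards : ∀ {m} {G H : Graph (suc m)} {v w} → card G v ≅ card H w →
                  degreeSum G + 2 * deg H w ≡ degreeSum H + 2 * deg G v
degreeSum-cards {G = G} {H} {v} {w} iso = begin
  degreeSum G + 2 * deg H w                            ≡⟨ cong (_+ 2 * deg H w) (degreeSum-card G v) ⟩
  degreeSum (card G v) + 2 * deg G v + 2 * deg H w
    ≡⟨ cong (λ s → s + 2 * deg G v + 2 * deg H w) (degreeSum-≅ {G = card G v} {card H w} iso) ⟩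
  degreeSum (card H w) + 2 * deg G v + 2 * deg H w
    ≡⟨ solve 3 (λ s a b → s :+ a :+ b := s :+ b :+ a) refl (degreeSum (card H w)) (2 * deg G v) (2 * deg H w) ⟩
  degreeSum (card H w) + 2 * deg H w + 2 * deg G v
    ≡⟨ cong (_+ 2 * deg G v) (≡.sym (degreeSum-card H w)) ⟩
  degreeSum H + 2 * deg G v                            ∎
  where
  open ≡-Reasoning
  open +-*-Solver

deg-from-balance : ∀ {m} {G H : Graph (suc m)} {v w a b} → card G v ≅ card H w →
                   degreeSum G + 2 * a ≡ degreeSum H + 2 * b → deg H w ≡ a → deg G v ≡ b
deg-from-balance {G = G} {H} {v} {w} {a} {b} iso balance deg≡a =
  ℕ.*-cancelˡ-≡ _ _ 2 (ℕ.+-cancelˡ-≡ (degreeSum H) _ _ (begin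
    degreeSum H + 2 * deg G v ≡⟨ ≡.sym (degreeSum-cards {G = G} {H} iso) ⟩
    degreeSum G + 2 * deg H w ≡⟨ cong (λ d → degreeSum G + 2 * d) deg≡a ⟩
    degreeSum G + 2 * a       ≡⟨ balance ⟩
    degreeSum H + 2 * b       ∎))
  where open ≡-Reasoning

minDeg-balance : ∀ {m} {G H : Graph (suc m)} → DeckIncluded G H →
                 degreeSum G + 2 * minDeg H ≤ degreeSum H + 2 * minDeg G
minDeg-balance {G = G} {H} D with minDeg-attained G
... | v , min≡ with D v
...   | w , iso = begin
  degreeSum G + 2 * minDeg H ≤⟨ ℕ.+-monoʳ-≤ (degreeSum G) (ℕ.*-monoʳ-≤ 2 (minDeg≤deg H w)) ⟩
  degreeSum G + 2 * deg H w  ≡⟨ degreeSum-cards {G = G} {H} iso ⟩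
  degreeSum H + 2 * deg G v  ≡⟨ cong (λ d → degreeSum H + 2 * d) (≡.sym min≡) ⟩
  degreeSum H + 2 * minDeg G ∎
  where open ℕ.≤-Reasoning

maxDeg-balance : ∀ {m} {G H : Graph (suc m)} → DeckIncluded G H →
                 degreeSum H + 2 * maxDeg G ≤ degreeSum G + 2 * maxDeg H
maxDeg-balance {G = G} {H} D with maxDeg-attained G
... | v , max≡ with D v
...   | w , iso = begin
  degreeSum H + 2 * maxDeg G ≡⟨ cong (λ d → degreeSum H + 2 * d) max≡ ⟩
  degreeSum H + 2 * deg G v  ≡⟨ ≡.sym (degreeSum-cards {G = G} {H} iso) ⟩
  degreeSum G + 2 * deg H w  ≤⟨ ℕ.+-monoʳ-≤ (degreeSum G) (ℕ.*-monoʳ-≤ 2 (deg≤maxDeg H w)) ⟩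
  degreeSum G + 2 * maxDeg H ∎
  where open ℕ.≤-Reasoning

minDeg-balance-≡ : ∀ {m} {G H : Graph (suc m)} → SameReducedDeck G H →
                   degreeSum G + 2 * minDeg H ≡ degreeSum H + 2 * minDeg G
minDeg-balance-≡ {G = G} {H} (D , D′) =
  ℕ.≤-antisym (minDeg-balance {G = G} {H} D) (minDeg-balance {G = H} {G} D′)

maxDeg-balance-≡ : ∀ {m} {G H : Graph (suc m)} → SameReducedDeck G H →
                   degreeSum G + 2 * maxDeg H ≡ degreeSum H + 2 * maxDeg G
maxDeg-balance-≡ {G = G} {H} (D , D′) =
  ℕ.≤-antisym (maxDeg-balance {G = H} {G} D′) (maxDeg-balance {G = G} {H} D)

balances-difference : ∀ p q a a′ b b′ → p + 2 * a′ ≡ q + 2 * a → p + 2 * b′ ≡ q + 2 * b →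
                      a + b′ ≡ a′ + b
balances-difference p q a a′ b b′ ea eb = ℕ.*-cancelˡ-≡ _ _ 2 (ℕ.+-cancelˡ-≡ (p + q) _ _ (begin
  p + q + 2 * (a + b′)
    ≡⟨ solve 4 (λ p q a b′ → p :+ q :+ con 2 :* (a :+ b′) := (q :+ con 2 :* a) :+ (p :+ con 2 :* b′))
               refl p q a b′ ⟩
  (q + 2 * a) + (p + 2 * b′) ≡⟨ cong₂ _+_ (≡.sym ea) eb ⟩
  (p + 2 * a′) + (q + 2 * b)
    ≡⟨ solve 4 (λ p q a′ b → (p :+ con 2 :* a′) :+ (q :+ con 2 :* b) := p :+ q :+ con 2 :* (a′ :+ b))
               refl p q a′ b ⟩
  p + q + 2 * (a′ + b)       ∎))
  where
  open ≡-Reasoning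
  open +-*-Solver

minDeg+maxDeg : ∀ {m} (G H : Graph (suc m)) → SameReducedDeck G H →
                minDeg G + maxDeg H ≡ minDeg H + maxDeg G
minDeg+maxDeg G H deck =
  balances-difference (degreeSum G) (degreeSum H) (minDeg G) (minDeg H) (maxDeg G) (maxDeg H)
                      (minDeg-balance-≡ {G = G} {H} deck) (maxDeg-balance-≡ {G = G} {H} deck)

minDeg≤-via-neighbour : ∀ {m} {G H : Graph (suc m)} → DeckIncluded G H →
                        ∀ {v u} → adj G v u ≡ true → minDeg H ≤ deg G v
minDeg≤-via-neighbour {m} {G} {H} D {v} {u} v∼u with D u
... | w , iso = begin
  minDeg H                             ≤⟨ minDeg≤deg H _ ⟩
  deg H (punchIn w (to x))             ≤⟨ deg≤suc-deg-card H w (to x) ⟩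
  suc (deg (card H w) (to x))          ≡⟨ cong suc (≡.sym (deg-≅ {G = card G u} {card H w} iso x)) ⟩
  suc (deg (card G u) x)               ≡⟨ ≡.sym (deg-punchIn-adj G u x x∼u) ⟩
  deg G (punchIn u x)                  ≡⟨ cong (deg G) (punchIn-punchOut u≢v) ⟩
  deg G v                              ∎
  where
  open ℕ.≤-Reasoning
  to : Fin m → Fin m
  to = Inverse.to (proj₁ iso)
  u≢v : u ≢ v
  u≢v refl = adj-irrefl G v∼u
  x : Fin m
  x = punchOut u≢v
  x∼u : adj G (punchIn u x) u ≡ true
  x∼u = subst (λ y → adj G y u ≡ true) (≡.sym (punchIn-punchOut u≢v)) v∼u

deg≤maxDeg-via-non-neighbour : ∀ {m} {G H : Graph (suc m)} → DeckIncluded H G →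
                               ∀ {w u} → u ≢ w → adj H w u ≡ false → deg H w ≤ maxDeg G
deg≤maxDeg-via-non-neighbour {m} {G} {H} D {w} {u} u≢w w≁u with D u
... | z , iso = begin
  deg H w                              ≡⟨ cong (deg H) (≡.sym (punchIn-punchOut u≢w)) ⟩
  deg H (punchIn u y)                  ≡⟨ deg-punchIn-nonadj H u y y≁u ⟩
  deg (card H u) y                     ≡⟨ deg-≅ {G = card H u} {card G z} iso y ⟩
  deg (card G z) (to y)                ≤⟨ deg-card≤deg G z (to y) ⟩
  deg G (punchIn z (to y))             ≤⟨ deg≤maxDeg G _ ⟩
  maxDeg G                             ∎
  where
  open ℕ.≤-Reasoning
  to : Fin m → Fin m
  to = Inverse.to (proj₁ iso)
  y : Fin m
  y = punchOut u≢w
  y≁u : adj H (punchIn u y) u ≡ false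
  y≁u = trans (cong (λ x → adj H x u) (punchIn-punchOut u≢w)) w≁u

matching-card-deletes-dominating :
  ∀ {k} {G H : Graph (suc (suc (suc k)))} {v d z w} → deg G v ≡ 0 → deg H d ≡ suc (suc k) →
  z ≢ v → card G z ≅ card H w → w ≡ d
matching-card-deletes-dominating {G = G} {H} {v} {d} {z} {w} v-isolated d-dominating z≢v iso
  with w Fin.≟ d
... | yes w≡d = w≡d
... | no  w≢d = ⊥-elim (¬isolated∧dominating (card H w) _ (punchOut w≢d)
                  (trans (≡.sym (deg-≅ {G = card G z} {card H w} iso (punchOut z≢v)))
                         (isolated-card G v-isolated z≢v))
                  (dominating-card H d-dominating w≢d))

matching-card-deletes-isolated :
  ∀ {k} {G H : Graph (suc (suc (suc k)))} {v d s z} → deg G v ≡ 0 → deg H d ≡ suc (suc k) →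
  s ≢ d → card H s ≅ card G z → z ≡ v
matching-card-deletes-isolated {G = G} {H} {v} {d} {s} {z} v-isolated d-dominating s≢d iso
  with z Fin.≟ v
... | yes z≡v = z≡v
... | no  z≢v = ⊥-elim (¬isolated∧dominating (card G z) (punchOut z≢v) _
                  (isolated-card G v-isolated z≢v)
                  (trans (≡.sym (deg-≅ {G = card H s} {card G z} iso (punchOut s≢d)))
                         (dominating-card H d-dominating s≢d)))

module IsolatedVersusDominating
  {j} (G₁ G₂ : Graph (suc (suc (suc (suc j))))) (deck : SameReducedDeck G₁ G₂)
  {v w} (v-isolated : deg G₁ v ≡ 0) (w-dominating : deg G₂ w ≡ suc (suc (suc j)))
  where

  minDeg₁≡0 : minDeg G₁ ≡ 0
  minDeg₁≡0 = ℕ.n≤0⇒n≡0 (subst (minDeg G₁ ≤_) v-isolated (minDeg≤deg G₁ v))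

  maxDeg₂≡ : maxDeg G₂ ≡ suc (suc (suc j))
  maxDeg₂≡ = ℕ.≤-antisym (maxDeg≤ G₂) (subst (_≤ maxDeg G₂) w-dominating (deg≤maxDeg G₂ w))

  card-avoiding-v : ∀ {z} → z ≢ v → card G₁ z ≅ card G₂ w
  card-avoiding-v {z} z≢v with proj₁ deck z
  ... | w′ , iso = subst (λ u → card G₁ z ≅ card G₂ u)
                     (matching-card-deletes-dominating {G = G₁} {G₂} v-isolated w-dominating z≢v iso) iso

  card-avoiding-w : ∀ {s} → s ≢ w → card G₂ s ≅ card G₁ v
  card-avoiding-w {s} s≢w with proj₂ deck s
  ... | z , iso = subst (λ u → card G₂ s ≅ card G₁ u)
                    (matching-card-deletes-isolated {G = G₁} {G₂} v-isolated w-dominating s≢w iso) iso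

  deg-avoiding-v : ∀ {z} → z ≢ v → deg G₁ z ≡ maxDeg G₁
  deg-avoiding-v z≢v = deg-from-balance {G = G₁} {G₂} (card-avoiding-v z≢v)
                         (maxDeg-balance-≡ {G = G₁} {G₂} deck) (trans w-dominating (≡.sym maxDeg₂≡))

  deg-avoiding-w : ∀ {s} → s ≢ w → deg G₂ s ≡ minDeg G₂
  deg-avoiding-w s≢w = deg-from-balance {G = G₂} {G₁} (card-avoiding-w s≢w)
                         (≡.sym (minDeg-balance-≡ {G = G₁} {G₂} deck)) (trans v-isolated (≡.sym minDeg₁≡0))

  deg-card-w : ∀ y → suc (deg (card G₂ w) y) ≡ minDeg G₂
  deg-card-w y = trans (≡.sym (deg-punchIn-adj G₂ w y y∼w)) (deg-avoiding-w (punchInᵢ≢i w y))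
    where
    y∼w : adj G₂ (punchIn w y) w ≡ true
    y∼w = adj-sym G₂ (dominating G₂ w w-dominating _ (punchInᵢ≢i w y))

  z₀ : Fin (suc (suc (suc (suc j))))
  z₀ = punchIn v zero

  z₀≢v : z₀ ≢ v
  z₀≢v = punchInᵢ≢i v zero

  iso₀ : card G₁ z₀ ≅ card G₂ w
  iso₀ = card-avoiding-v z₀≢v

  to₀ : Fin (suc (suc (suc j))) → Fin (suc (suc (suc j)))
  to₀ = Inverse.to (proj₁ iso₀)

  minDeg₂≡1 : minDeg G₂ ≡ 1
  minDeg₂≡1 = trans (≡.sym (deg-card-w (to₀ v₀)))
                    (cong suc (trans (≡.sym (deg-≅ {G = card G₁ z₀} {card G₂ w} iso₀ v₀))
                                     (isolated-card G₁ v-isolated z₀≢v)))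
    where
    v₀ : Fin (suc (suc (suc j)))
    v₀ = punchOut z₀≢v

  card-z₀-edgeless : ∀ x → deg (card G₁ z₀) x ≡ 0
  card-z₀-edgeless x = trans (deg-≅ {G = card G₁ z₀} {card G₂ w} iso₀ x)
                             (ℕ.suc-injective (trans (deg-card-w (to₀ x)) minDeg₂≡1))

  maxDeg₁≡ : maxDeg G₁ ≡ suc (suc j)
  maxDeg₁≡ = ℕ.suc-injective (begin
    suc (maxDeg G₁)         ≡⟨ cong (_+ maxDeg G₁) (≡.sym minDeg₂≡1) ⟩
    minDeg G₂ + maxDeg G₁   ≡⟨ ≡.sym (minDeg+maxDeg G₁ G₂ deck) ⟩
    minDeg G₁ + maxDeg G₂   ≡⟨ cong₂ _+_ minDeg₁≡0 maxDeg₂≡ ⟩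
    suc (suc (suc j))       ∎)
    where open ≡-Reasoning

  contradiction : ⊥
  contradiction = ℕ.<⇒≱ (s≤s (s≤s z≤n)) (begin
    suc (suc j)                  ≡⟨ ≡.sym maxDeg₁≡ ⟩
    maxDeg G₁                    ≡⟨ ≡.sym (deg-avoiding-v x≢v) ⟩
    deg G₁ (punchIn z₀ x)        ≤⟨ deg≤suc-deg-card G₁ z₀ x ⟩
    suc (deg (card G₁ z₀) x)     ≡⟨ cong suc (card-z₀-edgeless x) ⟩
    1                            ∎)
    where
    open ℕ.≤-Reasoning
    v₀ x : Fin (suc (suc (suc j)))
    v₀ = punchOut z₀≢v
    x = punchIn v₀ zero
    x≢v : punchIn z₀ x ≢ v
    x≢v e = punchInᵢ≢i v₀ zero (punchIn-injective z₀ _ _ (trans e (≡.sym (punchIn-punchOut z₀≢v))))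

maxDeg<-of-minDeg< : ∀ {m} (G H : Graph (suc m)) → SameReducedDeck G H →
                     minDeg G < minDeg H → maxDeg G < maxDeg H
maxDeg<-of-minDeg< G H deck δ< with maxDeg H ℕ.≤? maxDeg G
... | no  Δ≰ = ℕ.≰⇒> Δ≰
... | yes Δ≤ = ⊥-elim (ℕ.<-irrefl (minDeg+maxDeg G H deck) (ℕ.+-mono-<-≤ δ< Δ≤))

¬minDeg< : ∀ {j} (G₁ G₂ : Graph (suc (suc (suc (suc j))))) → SameReducedDeck G₁ G₂ →
           minDeg G₁ < minDeg G₂ → ⊥
¬minDeg< G₁ G₂ deck δ< with minDeg-attained G₁ | maxDeg-attained G₂
... | v , min≡ | w , max≡ with neighbour-or-isolated G₁ v | non-neighbour-or-dominating G₂ w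
...   | inj₁ (u , v∼u) | _ =
  ℕ.<⇒≱ δ< (subst (minDeg G₂ ≤_) (≡.sym min≡) (minDeg≤-via-neighbour {G = G₁} {G₂} (proj₁ deck) v∼u))
...   | inj₂ _ | inj₁ (u , u≢w , w≁u) =
  ℕ.<⇒≱ (maxDeg<-of-minDeg< G₁ G₂ deck δ<)
    (subst (_≤ maxDeg G₁) (≡.sym max≡) (deg≤maxDeg-via-non-neighbour {G = G₁} {G₂} (proj₂ deck) u≢w w≁u))
...   | inj₂ v-isolated | inj₂ w-dominating =
  IsolatedVersusDominating.contradiction G₁ G₂ deck v-isolated w-dominating

minDeg-≡ : ∀ {j} (G₁ G₂ : Graph (suc (suc (suc (suc j))))) → SameReducedDeck G₁ G₂ →
           minDeg G₁ ≡ minDeg G₂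
minDeg-≡ G₁ G₂ deck with ℕ.<-cmp (minDeg G₁) (minDeg G₂)
... | tri< δ< _ _ = ⊥-elim (¬minDeg< G₁ G₂ deck δ<)
... | tri≈ _ δ≡ _ = δ≡
... | tri> _ _ δ> = ⊥-elim (¬minDeg< G₂ G₁ (swap deck) δ>)

maxDeg-≡ : ∀ {j} (G₁ G₂ : Graph (suc (suc (suc (suc j))))) → SameReducedDeck G₁ G₂ →
           maxDeg G₁ ≡ maxDeg G₂
maxDeg-≡ G₁ G₂ deck = ℕ.+-cancelˡ-≡ (minDeg G₁) _ _ (begin
  minDeg G₁ + maxDeg G₁ ≡⟨ cong (_+ maxDeg G₁) (minDeg-≡ G₁ G₂ deck) ⟩
  minDeg G₂ + maxDeg G₁ ≡⟨ ≡.sym (minDeg+maxDeg G₁ G₂ deck) ⟩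
  minDeg G₁ + maxDeg G₂ ∎)
  where open ≡-Reasoning

-- Cycles

Homomorphism : ∀ {n n′} → Graph n → Graph n′ → (Fin n → Fin n′) → Set
Homomorphism G H φ = ∀ x y → adj G x y ≡ true → adj H (φ x) (φ y) ≡ true

punchIn-homomorphism : ∀ {m} (G : Graph (suc m)) v → Homomorphism (card G v) G (punchIn v)
punchIn-homomorphism G v x y x∼y = x∼y

≅-homomorphism : ∀ {n m} {G : Graph n} {H : Graph m} (iso : G ≅ H) → Homomorphism G H (Inverse.to (proj₁ iso))
≅-homomorphism (e , adj≡) x y x∼y = trans (≡.sym (adj≡ x y)) x∼y

≅-card-homomorphism : ∀ {m} {G H : Graph (suc m)} {v w} (iso : card G v ≅ card H w) →
                       Homomorphism (card G v) H (λ x → punchIn w (Inverse.to (proj₁ iso) x))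
≅-card-homomorphism {G = G} {H} {v} {w} iso x y x∼y = ≅-homomorphism {G = card G v} {card H w} iso x y x∼y

HasCycle-map : ∀ {n n′} {G : Graph n} {H : Graph n′} (φ : Fin n → Fin n′) → Injective _≡_ _≡_ φ →
               Homomorphism G H φ → ∀ {k} → HasCycle G k → HasCycle H k
HasCycle-map φ φ-injective φ-hom (f , f-injective , f-cycle) =
  (λ i → φ (f i)) , (λ e → f-injective (φ-injective e)) , (λ i j step → φ-hom _ _ (f-cycle i j step))

HasCycle-≅ : ∀ {n m} {G : Graph n} {H : Graph m} → G ≅ H → ∀ {k} → HasCycle G k → HasCycle H k
HasCycle-≅ {G = G} {H} iso =
  HasCycle-map {G = G} {H} _ (Injection.injective (↔⇒↣ (proj₁ iso))) (≅-homomorphism {G = G} {H} iso)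

HasCycle-card : ∀ {m} (G : Graph (suc m)) v {k} → HasCycle (card G v) k → HasCycle G k
HasCycle-card G v = HasCycle-map {G = card G v} {G} (punchIn v) (punchIn-injective v _ _) (punchIn-homomorphism G v)

HasCycle-avoiding : ∀ {m} (G : Graph (suc m)) v {k} (c : HasCycle G k) → (∀ i → proj₁ c i ≢ v) →
                    HasCycle (card G v) k
HasCycle-avoiding {m} G v {k} (f , f-injective , f-cycle) avoids = f′ , f′-injective , f′-cycle
  where
  v≢f : ∀ i → v ≢ f i
  v≢f i e = avoids i (≡.sym e)
  f′ : Fin k → Fin m
  f′ i = punchOut (v≢f i)
  back : ∀ i → punchIn v (f′ i) ≡ f i
  back i = punchIn-punchOut (v≢f i)
  f′-injective : Injective _≡_ _≡_ f′
  f′-injective {i} {j} e = f-injective (trans (≡.sym (back i)) (trans (cong (punchIn v) e) (back j)))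
  f′-cycle : ∀ i j → CycStep _ i j → adj (card G v) (f′ i) (f′ j) ≡ true
  f′-cycle i j step = trans (cong₂ (adj G) (back i) (back j)) (f-cycle i j step)

missed-vertex : ∀ {k n} → k < n → (f : Fin k → Fin n) → ∃ λ v → ∀ i → f i ≢ v
missed-vertex {k} {n} k<n f
  with ¬∀⟶∃¬ n (λ v → ∃ λ i → f i ≡ v) (λ v → any? (λ i → f i Fin.≟ v)) ¬surjective
  where
  ¬surjective : ¬ (∀ v → ∃ λ i → f i ≡ v)
  ¬surjective hit = ℕ.<⇒≱ k<n (Fin.injective⇒≤ {f = λ v → proj₁ (hit v)}
    (λ {u} {v} e → trans (≡.sym (proj₂ (hit u))) (trans (cong f e) (proj₂ (hit v)))))
... | v , unhit = v , λ i e → unhit (i , e)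

HasCycle-transfer : ∀ {m} {G H : Graph (suc m)} → DeckIncluded G H →
                    ∀ {k} → k < suc m → HasCycle G k → HasCycle H k
HasCycle-transfer {G = G} {H} D k<n c with missed-vertex k<n (proj₁ c)
... | v , avoids with D v
...   | w , iso = HasCycle-card H w (HasCycle-≅ {G = card G v} {card H w} iso (HasCycle-avoiding G v c avoids))

-- Walks

data ParityWalk {n} (G : Graph n) : Fin n → Fin n → Parity → Set where
  []  : ∀ {a} → ParityWalk G a a 0ℙ
  _∷_ : ∀ {a b c p} → adj G a b ≡ true → ParityWalk G b c p → ParityWalk G a c (1ℙ ⊕ p)

module _ {n} {G : Graph n} where

  _++ᵖ_ : ∀ {a b c p q} → ParityWalk G a b p → ParityWalk G b c q → ParityWalk G a c (p ⊕ q)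
  _++ᵖ_ []                  w₂ = w₂
  _++ᵖ_ {q = q} (_∷_ {p = p} e w₁) w₂ =
    subst (ParityWalk G _ _) (≡.sym (Parity.+-assoc 1ℙ p q)) (e ∷ (w₁ ++ᵖ w₂))

  reverseᵖ : ∀ {a b p} → ParityWalk G a b p → ParityWalk G b a p
  reverseᵖ []                       = []
  reverseᵖ (_∷_ {p = p} e w) =
    subst (ParityWalk G _ _) (Parity.+-comm p 1ℙ) (reverseᵖ w ++ᵖ (adj-sym G e ∷ []))

mapᵖ : ∀ {n n′} {G : Graph n} {H : Graph n′} (φ : Fin n → Fin n′) → Homomorphism G H φ →
       ∀ {a b p} → ParityWalk G a b p → ParityWalk H (φ a) (φ b) p
mapᵖ φ φ-hom []      = []
mapᵖ φ φ-hom (e ∷ w) = φ-hom _ _ e ∷ mapᵖ φ φ-hom w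

-- Walk G a xs b is the walk a, x₁, …, xₖ, b through the inner vertices xs = x₁ … xₖ; its length
-- is suc (length xs).
Walk : ∀ {n} → Graph n → Fin n → List (Fin n) → Fin n → Set
Walk G a []       b = adj G a b ≡ true
Walk G a (x ∷ xs) b = adj G a x ≡ true × Walk G x xs b

OddClosedWalk : ∀ {n} → Graph n → Set
OddClosedWalk {n} G = Σ (Fin n) λ a → Σ (List (Fin n)) λ xs → Walk G a xs a × parity (suc (length xs)) ≡ 1ℙ

module _ {n} {G : Graph n} where

  walk-split : ∀ {a b} xs v ys → Walk G a (xs ++ v ∷ ys) b → Walk G a xs v × Walk G v ys b
  walk-split []       v ys (a∼v , w) = a∼v , w
  walk-split (x ∷ xs) v ys (a∼x , w) = map₁ (a∼x ,_) (walk-split xs v ys w)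

  walk-join : ∀ {a b} xs v ys → Walk G a xs v → Walk G v ys b → Walk G a (xs ++ v ∷ ys) b
  walk-join []       v ys a∼v       w′ = a∼v , w′
  walk-join (x ∷ xs) v ys (a∼x , w) w′ = a∼x , walk-join xs v ys w w′

  walk-rotate : ∀ {a} bs u cs → Walk G a (bs ++ u ∷ cs) a → Walk G u (cs ++ a ∷ bs) u
  walk-rotate bs u cs w with walk-split bs u cs w
  ... | w₁ , w₂ = walk-join cs _ bs w₂ w₁

  walk→parityWalk : ∀ {a b} xs → Walk G a xs b → ParityWalk G a b (parity (suc (length xs)))
  walk→parityWalk []       a∼b       = a∼b ∷ []
  walk→parityWalk (x ∷ xs) (a∼x , w) =
    subst (ParityWalk G _ _) (Parity.suc-homo-⁻¹ (length xs)) (a∼x ∷ walk→parityWalk xs w)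

  parityWalk→walk : ∀ {a b c p} → adj G a b ≡ true → ParityWalk G b c p →
                    ∃ λ xs → Walk G a xs c × parity (suc (length xs)) ≡ 1ℙ ⊕ p
  parityWalk→walk a∼b []          = [] , a∼b , refl
  parityWalk→walk a∼b (b∼x ∷ w) with parityWalk→walk b∼x w
  ... | xs , w′ , parity≡ = _ ∷ xs , (a∼b , w′) ,
        trans (≡.sym (Parity.suc-homo-⁻¹ (length xs))) (cong (1ℙ ⊕_) parity≡)

  oddParityWalk→OddClosedWalk : ∀ {a} → ParityWalk G a a 1ℙ → OddClosedWalk G
  oddParityWalk→OddClosedWalk w = closed w refl refl
    where
    closed : ∀ {a b p} → ParityWalk G a b p → b ≡ a → p ≡ 1ℙ → OddClosedWalk G
    closed []        _    ()
    closed (a∼x ∷ w) refl p≡1 with parityWalk→walk a∼x w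
    ... | xs , w′ , parity≡ = _ , xs , w′ , trans parity≡ p≡1

walk-map : ∀ {n n′} {G : Graph n} {H : Graph n′} (φ : Fin n → Fin n′) → Homomorphism G H φ →
           ∀ {a b} xs → Walk G a xs b → Walk H (φ a) (map φ xs) (φ b)
walk-map φ φ-hom []       a∼b       = φ-hom _ _ a∼b
walk-map φ φ-hom (x ∷ xs) (a∼x , w) = φ-hom _ _ a∼x , walk-map φ φ-hom xs w

walk-lower : ∀ {m} (G : Graph (suc m)) v {x y} xs → Walk G x xs y →
             (v≢x : v ≢ x) → v ∉ xs → (v≢y : v ≢ y) →
             ∃ λ ys → map (punchIn v) ys ≡ xs × Walk (card G v) (punchOut v≢x) ys (punchOut v≢y)
walk-lower G v []       x∼y       v≢x v∉ v≢y =
  [] , refl , trans (cong₂ (adj G) (punchIn-punchOut v≢x) (punchIn-punchOut v≢y)) x∼y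
walk-lower G v (z ∷ zs) (x∼z , w) v≢x v∉ v≢y
  with walk-lower G v zs w (λ v≡z → v∉ (here v≡z)) (λ v∈ → v∉ (there v∈)) v≢y
... | ys , ys≡ , w′ = punchOut v≢z ∷ ys , cong₂ _∷_ (punchIn-punchOut v≢z) ys≡ ,
                      trans (cong₂ (adj G) (punchIn-punchOut v≢x) (punchIn-punchOut v≢z)) x∼z , w′
  where
  v≢z : v ≢ z
  v≢z v≡z = v∉ (here v≡z)

OddClosedWalk-transfer : ∀ {m} {G H : Graph (suc m)} → DeckIncluded G H →
                         ∀ {a} xs → Walk G a xs a → parity (suc (length xs)) ≡ 1ℙ →
                         ∀ v → v ∉ a ∷ xs → OddClosedWalk H
OddClosedWalk-transfer {m} {G} {H} D {a} xs w odd v v∉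
  with walk-lower G v xs w (λ v≡a → v∉ (here v≡a)) (λ v∈ → v∉ (there v∈)) (λ v≡a → v∉ (here v≡a))
     | D v
... | ys , ys≡ , card-walk | u , iso =
  _ , map φ ys , walk-map φ (≅-card-homomorphism {G = G} {H} iso) ys card-walk , odd′
  where
  φ : Fin m → Fin (suc m)
  φ x = punchIn u (Inverse.to (proj₁ iso) x)
  odd′ : parity (suc (length (map φ ys))) ≡ 1ℙ
  odd′ = trans (cong (λ k → parity (suc k)) (trans (List.length-map φ ys)
                  (trans (≡.sym (List.length-map (punchIn v) ys)) (cong length ys≡)))) odd

toParity : Bool → Parity
toParity false = 0ℙ
toParity true  = 1ℙ

toParity-≢ : ∀ {x y} → x ≢ y → toParity y ≡ 1ℙ ⊕ toParity x
toParity-≢ {false} {false} x≢y = ⊥-elim (x≢y refl)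
toParity-≢ {false} {true}  x≢y = refl
toParity-≢ {true}  {false} x≢y = refl
toParity-≢ {true}  {true}  x≢y = ⊥-elim (x≢y refl)

parityWalk-colour : ∀ {n} {G : Graph n} (c : Fin n → Bool) → (∀ u v → adj G u v ≡ true → c u ≢ c v) →
                    ∀ {a b p} → ParityWalk G a b p → toParity (c b) ≡ p ⊕ toParity (c a)
parityWalk-colour c proper [] = refl
parityWalk-colour c proper {a} (_∷_ {b = x} {p = p} a∼x w) = begin
  toParity (c _)               ≡⟨ parityWalk-colour c proper w ⟩
  p ⊕ toParity (c x)           ≡⟨ cong (p ⊕_) (toParity-≢ (proper a x a∼x)) ⟩
  p ⊕ (1ℙ ⊕ toParity (c a))    ≡⟨ ≡.sym (Parity.+-assoc p 1ℙ _) ⟩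
  (p ⊕ 1ℙ) ⊕ toParity (c a)    ≡⟨ cong (_⊕ toParity (c a)) (Parity.+-comm p 1ℙ) ⟩
  (1ℙ ⊕ p) ⊕ toParity (c a)    ∎
  where open ≡-Reasoning

bipartite-¬OddClosedWalk : ∀ {n} {G : Graph n} → Bipartite G → ¬ OddClosedWalk G
bipartite-¬OddClosedWalk {G = G} (c , proper) (a , xs , w , odd) =
  Parity.p≢p⁻¹ _ (parityWalk-colour c proper (subst (ParityWalk G a a) odd (walk→parityWalk xs w)))

-- Two-colouring or odd closed walk

-- The walks from the roots are what let a failed extension produce an odd closed walk.
record Bipartition {n} (G : Graph n) : Set where
  field
    colour    : Fin n → Parity
    root      : Fin n → Fin n
    proper    : ∀ u v → adj G u v ≡ true → colour u ≢ colour v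
    root-edge : ∀ u v → adj G u v ≡ true → root u ≡ root v
    root-idem : ∀ x → root (root x) ≡ root x
    from-root : ∀ x → ParityWalk G (root x) x (colour (root x) ⊕ colour x)

toBool : Parity → Bool
toBool 0ℙ = false
toBool 1ℙ = true

toBool-injective : ∀ {p q} → toBool p ≡ toBool q → p ≡ q
toBool-injective {0ℙ} {0ℙ} _ = refl
toBool-injective {1ℙ} {1ℙ} _ = refl

Bipartition→Bipartite : ∀ {n} {G : Graph n} → Bipartition G → Bipartite G
Bipartition→Bipartite B = (λ v → toBool (colour v)) , λ u v u∼v same → proper u v u∼v (toBool-injective same)
  where open Bipartition B

-- The components of G - 0 met by neighbours of 0 are merged into one rooted at 0, their colours
-- shifted so that every neighbour of 0 gets colour 1ℙ. This fails only if two neighbours of 0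
-- in one component have different colours, and then they close an odd walk through 0.
module AddVertex {m} (G : Graph (suc m)) (B : Bipartition (card G zero)) where

  open Bipartition B

  lift : ∀ {a b p} → ParityWalk (card G zero) a b p → ParityWalk G (suc a) (suc b) p
  lift = mapᵖ suc (punchIn-homomorphism G zero)

  Neighbour : Fin m → Set
  Neighbour a = adj G zero (suc a) ≡ true

  neighbour? : ∀ a → Dec (Neighbour a)
  neighbour? a = adj G zero (suc a) Bool.≟ true

  Conflict : Set
  Conflict = ∃ λ a → ∃ λ a′ → Neighbour a × Neighbour a′ × root a ≡ root a′ × colour a ≢ colour a′

  conflict? : Dec Conflict
  conflict? = any? λ a → any? λ a′ →
    neighbour? a ×-dec neighbour? a′ ×-dec root a Fin.≟ root a′ ×-dec ¬? (colour a Parity.≟ colour a′)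

  odd-through-zero : Conflict → ParityWalk G zero zero 1ℙ
  odd-through-zero (a , a′ , 0∼a , 0∼a′ , same-root , colour≢) =
    subst (ParityWalk G zero zero) (parity≡ (colour (root a′)) (colour a) (colour a′) colour≢) walk
    where
    to-root : ParityWalk G zero (suc (root a′)) (1ℙ ⊕ (colour (root a′) ⊕ colour a))
    to-root = subst (λ ρ → ParityWalk G zero (suc ρ) (1ℙ ⊕ (colour ρ ⊕ colour a))) same-root
                    (0∼a ∷ lift (reverseᵖ (from-root a)))
    walk : ParityWalk G zero zero
                      ((1ℙ ⊕ (colour (root a′) ⊕ colour a)) ⊕ ((colour (root a′) ⊕ colour a′) ⊕ 1ℙ))
    walk = to-root ++ᵖ (lift (from-root a′) ++ᵖ (adj-sym G 0∼a′ ∷ []))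
    parity≡ : ∀ ρ x y → x ≢ y → (1ℙ ⊕ (ρ ⊕ x)) ⊕ ((ρ ⊕ y) ⊕ 1ℙ) ≡ 1ℙ
    parity≡ 0ℙ 0ℙ 0ℙ x≢y = ⊥-elim (x≢y refl)
    parity≡ 0ℙ 0ℙ 1ℙ x≢y = refl
    parity≡ 0ℙ 1ℙ 0ℙ x≢y = refl
    parity≡ 0ℙ 1ℙ 1ℙ x≢y = ⊥-elim (x≢y refl)
    parity≡ 1ℙ 0ℙ 0ℙ x≢y = ⊥-elim (x≢y refl)
    parity≡ 1ℙ 0ℙ 1ℙ x≢y = refl
    parity≡ 1ℙ 1ℙ 0ℙ x≢y = refl
    parity≡ 1ℙ 1ℙ 1ℙ x≢y = ⊥-elim (x≢y refl)

  module Extend (no-conflict : ¬ Conflict) where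

    Touched : Fin m → Set
    Touched ρ = ∃ λ a → Neighbour a × root a ≡ ρ

    touched? : ∀ ρ → Dec (Touched ρ)
    touched? ρ = any? λ a → neighbour? a ×-dec root a Fin.≟ ρ

    shift-of : ∀ {ρ} → Dec (Touched ρ) → Parity
    shift-of (yes (a , _)) = 1ℙ ⊕ colour a
    shift-of (no  _)       = 0ℙ

    attach-of : ∀ {ρ} → Dec (Touched ρ) → Fin (suc m)
    attach-of     (yes _) = zero
    attach-of {ρ} (no  _) = suc ρ

    shift : Fin m → Parity
    shift ρ = shift-of (touched? ρ)

    attach : Fin m → Fin (suc m)
    attach ρ = attach-of (touched? ρ)

    data Status (ρ : Fin m) (r : Fin (suc m)) (s : Parity) : Set where
      touched   : ∀ a → Neighbour a → root a ≡ ρ → r ≡ zero → s ≡ 1ℙ ⊕ colour a → Status ρ r s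
      untouched : ¬ Touched ρ → r ≡ suc ρ → s ≡ 0ℙ → Status ρ r s

    status : ∀ ρ → Status ρ (attach ρ) (shift ρ)
    status ρ = status-of (touched? ρ)
      where
      status-of : (t : Dec (Touched ρ)) → Status ρ (attach-of t) (shift-of t)
      status-of (yes (a , 0∼a , root≡)) = touched a 0∼a root≡ refl refl
      status-of (no  ¬touched)          = untouched ¬touched refl refl

    same-colour : ∀ {a a′} → Neighbour a → Neighbour a′ → root a ≡ root a′ → colour a ≡ colour a′
    same-colour {a} {a′} 0∼a 0∼a′ root≡ with colour a Parity.≟ colour a′
    ... | yes same = same
    ... | no  diff = ⊥-elim (no-conflict (a , a′ , 0∼a , 0∼a′ , root≡ , diff))

    colour′ : Fin (suc m) → Parity
    colour′ zero    = 0ℙ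
    colour′ (suc x) = colour x ⊕ shift (root x)

    root′ : Fin (suc m) → Fin (suc m)
    root′ zero    = zero
    root′ (suc x) = attach (root x)

    colour′-neighbour : ∀ {a} → Neighbour a → colour′ (suc a) ≡ 1ℙ
    colour′-neighbour {a} 0∼a with status (root a)
    ... | touched a* 0∼a* root≡ _ shift≡ = begin
      colour a ⊕ shift (root a)  ≡⟨ cong (colour a ⊕_) shift≡ ⟩
      colour a ⊕ (1ℙ ⊕ colour a*)
        ≡⟨ cong (λ p → colour a ⊕ (1ℙ ⊕ p)) (same-colour 0∼a* 0∼a root≡) ⟩
      colour a ⊕ (1ℙ ⊕ colour a)  ≡⟨ Parity.p+p⁻¹≡1ℙ (colour a) ⟩
      1ℙ                          ∎
      where open ≡-Reasoning
    ... | untouched ¬touched _ _ = ⊥-elim (¬touched (a , 0∼a , refl))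

    attach-neighbour : ∀ {a} → Neighbour a → attach (root a) ≡ zero
    attach-neighbour {a} 0∼a with status (root a)
    ... | touched _ _ _ attach≡ _ = attach≡
    ... | untouched ¬touched _ _  = ⊥-elim (¬touched (a , 0∼a , refl))

    proper′ : ∀ u v → adj G u v ≡ true → colour′ u ≢ colour′ v
    proper′ zero    zero    0∼0 _ = adj-irrefl G 0∼0
    proper′ zero    (suc a) 0∼a eq with trans eq (colour′-neighbour 0∼a)
    ... | ()
    proper′ (suc a) zero    a∼0 eq with trans (≡.sym eq) (colour′-neighbour (adj-sym G a∼0))
    ... | ()
    proper′ (suc x) (suc y) x∼y eq = proper x y x∼y (Parity.+-cancelʳ-≡ _ _ _ (trans eq
      (cong (λ ρ → colour y ⊕ shift ρ) (≡.sym (root-edge x y x∼y)))))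

    root-edge′ : ∀ u v → adj G u v ≡ true → root′ u ≡ root′ v
    root-edge′ zero    zero    _   = refl
    root-edge′ zero    (suc a) 0∼a = ≡.sym (attach-neighbour 0∼a)
    root-edge′ (suc a) zero    a∼0 = attach-neighbour (adj-sym G a∼0)
    root-edge′ (suc x) (suc y) x∼y = cong attach (root-edge x y x∼y)

    root-idem′ : ∀ x → root′ (root′ x) ≡ root′ x
    root-idem′ zero    = refl
    root-idem′ (suc x) with status (root x)
    ... | touched _ _ _ attach≡ _ = trans (cong root′ attach≡) (≡.sym attach≡)
    ... | untouched _ attach≡ _   = trans (cong root′ attach≡) (cong attach (root-idem x))

    from-root′ : ∀ x → ParityWalk G (root′ x) x (colour′ (root′ x) ⊕ colour′ x)
    from-root′ zero    = []
    from-root′ (suc x) with status (root x)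
    ... | touched a 0∼a root≡ attach≡ shift≡ =
      subst₂ (λ r s → ParityWalk G r (suc x) (colour′ r ⊕ (colour x ⊕ s))) (≡.sym attach≡) (≡.sym shift≡)
             (subst (ParityWalk G zero (suc x)) (parity≡ (colour (root x)) (colour a) (colour x)) walk)
      where
      to-root : ParityWalk G zero (suc (root x)) (1ℙ ⊕ (colour (root x) ⊕ colour a))
      to-root = subst (λ ρ → ParityWalk G zero (suc ρ) (1ℙ ⊕ (colour ρ ⊕ colour a))) root≡
                      (0∼a ∷ lift (reverseᵖ (from-root a)))
      walk : ParityWalk G zero (suc x) ((1ℙ ⊕ (colour (root x) ⊕ colour a)) ⊕ (colour (root x) ⊕ colour x))
      walk = to-root ++ᵖ lift (from-root x)
      parity≡ : ∀ ρ a x → (1ℙ ⊕ (ρ ⊕ a)) ⊕ (ρ ⊕ x) ≡ x ⊕ (1ℙ ⊕ a)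
      parity≡ 0ℙ 0ℙ 0ℙ = refl
      parity≡ 0ℙ 0ℙ 1ℙ = refl
      parity≡ 0ℙ 1ℙ 0ℙ = refl
      parity≡ 0ℙ 1ℙ 1ℙ = refl
      parity≡ 1ℙ 0ℙ 0ℙ = refl
      parity≡ 1ℙ 0ℙ 1ℙ = refl
      parity≡ 1ℙ 1ℙ 0ℙ = refl
      parity≡ 1ℙ 1ℙ 1ℙ = refl
    ... | untouched _ attach≡ shift≡ =
      subst (λ r → ParityWalk G r (suc x) (colour′ r ⊕ colour′ (suc x))) (≡.sym attach≡)
            (subst (ParityWalk G (suc (root x)) (suc x)) parity≡ (lift (from-root x)))
      where
      unshifted : ∀ y → y ⊕ shift (root x) ≡ y
      unshifted y = trans (cong (y ⊕_) shift≡) (Parity.+-identityʳ y)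
      parity≡ : colour (root x) ⊕ colour x
              ≡ (colour (root x) ⊕ shift (root (root x))) ⊕ (colour x ⊕ shift (root x))
      parity≡ = ≡.sym (cong₂ _⊕_ (trans (cong (λ ρ → colour (root x) ⊕ shift ρ) (root-idem x))
                                        (unshifted (colour (root x))))
                                 (unshifted (colour x)))

    bipartition : Bipartition G
    bipartition = record
      { colour = colour′ ; root = root′ ; proper = proper′ ; root-edge = root-edge′
      ; root-idem = root-idem′ ; from-root = from-root′ }

bipartition-or-odd : ∀ n (G : Graph n) → Bipartition G ⊎ ∃ λ a → ParityWalk G a a 1ℙ
bipartition-or-odd zero    G = inj₁ (record
  { colour = λ () ; root = λ () ; proper = λ () ; root-edge = λ () ; root-idem = λ () ; from-root = λ () })
bipartition-or-odd (suc m) G with bipartition-or-odd m (card G zero)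
... | inj₂ (a , odd) = inj₂ (suc a , mapᵖ suc (punchIn-homomorphism G zero) odd)
... | inj₁ B with AddVertex.conflict? G B
...   | yes conflict    = inj₂ (zero , AddVertex.odd-through-zero G B conflict)
...   | no  no-conflict = inj₁ (AddVertex.Extend.bipartition G B no-conflict)

-- Shortest odd closed walks

∷ʳ-as-∷ : ∀ {A : Set} (xs : List A) y → ∃ λ z → ∃ λ zs → xs ∷ʳ y ≡ z ∷ zs
∷ʳ-as-∷ []       y = y , [] , refl
∷ʳ-as-∷ (x ∷ xs) y = x , xs ∷ʳ y , refl

∷-as-∷ʳ : ∀ {A : Set} (x : A) xs → ∃ λ ys → ∃ λ y → x ∷ xs ≡ ys ∷ʳ y
∷-as-∷ʳ x []        = [] , x , refl
∷-as-∷ʳ x (x′ ∷ xs) with ∷-as-∷ʳ x′ xs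
... | ys , y , eq = x ∷ ys , y , cong (x ∷_) eq

chord-lengths : ∀ {A : Set} (bs : List A) x c cs y ds →
                length (c ∷ cs ++ y ∷ []) < length (bs ++ x ∷ c ∷ cs ++ y ∷ ds) ×
                length (bs ++ x ∷ y ∷ ds) < length (bs ++ x ∷ c ∷ cs ++ y ∷ ds) ×
                suc (length (c ∷ cs ++ y ∷ [])) + suc (length (bs ++ x ∷ y ∷ ds))
                  ≡ suc (suc (suc (length (bs ++ x ∷ c ∷ cs ++ y ∷ ds))))
chord-lengths bs x c cs y ds =
  subst₂ _<_ (≡.sym length₁) (≡.sym length-all)
             (ℕ.≤-trans (s≤s (s≤s (ℕ.+-monoʳ-≤ C (s≤s z≤n)))) (ℕ.m≤n+m _ B)) ,
  subst₂ _<_ (≡.sym length₂) (≡.sym length-all) (ℕ.+-monoʳ-< B (s≤s (s≤s (ℕ.m≤n+m _ C)))) ,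
  (begin
    suc (length (c ∷ cs ++ y ∷ [])) + suc (length (bs ++ x ∷ y ∷ ds))
      ≡⟨ cong₂ (λ k l → suc k + suc l) length₁ length₂ ⟩
    suc (suc (C + 1)) + suc (B + suc (suc D))
      ≡⟨ solve 3 (λ B C D → con 2 :+ (C :+ con 1) :+ (con 1 :+ (B :+ (con 2 :+ D)))
                         := con 3 :+ (B :+ (con 2 :+ (C :+ (con 1 :+ D))))) refl B C D ⟩
    suc (suc (suc (B + suc (suc (C + suc D)))))
      ≡⟨ cong (λ k → suc (suc (suc k))) (≡.sym length-all) ⟩
    suc (suc (suc (length (bs ++ x ∷ c ∷ cs ++ y ∷ ds)))) ∎)
  where
  open ≡-Reasoning
  open +-*-Solver
  B C D : ℕ
  B = length bs
  C = length cs
  D = length ds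
  length-all : length (bs ++ x ∷ c ∷ cs ++ y ∷ ds) ≡ B + suc (suc (C + suc D))
  length-all = trans (List.length-++ bs) (cong (λ k → B + suc (suc k)) (List.length-++ cs))
  length₁ : length (c ∷ cs ++ y ∷ []) ≡ suc (C + 1)
  length₁ = cong suc (List.length-++ cs)
  length₂ : length (bs ++ x ∷ y ∷ ds) ≡ B + suc (suc D)
  length₂ = List.length-++ bs

NoOddClosedWalkBelow : ∀ {n} → Graph n → ℕ → Set
NoOddClosedWalkBelow G k = ∀ {a} xs → length xs < k → Walk G a xs a → parity (suc (length xs)) ≢ 1ℙ

-- If the walk left and re-entered a through the same neighbour, dropping a would leave a shorter
-- odd closed walk.
two≤deg-of-shortest : ∀ {n} {G : Graph n} {a} xs → Walk G a xs a → parity (suc (length xs)) ≡ 1ℙ →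
                      NoOddClosedWalkBelow G (length xs) → 2 ≤ deg G a
two≤deg-of-shortest {G = G} [] a∼a _ _ = ⊥-elim (adj-irrefl G a∼a)
two≤deg-of-shortest {G = G} (f ∷ rest) (a∼f , w) odd shortest with initLast rest
... | []         with odd
...   | ()
two≤deg-of-shortest {G = G} (f ∷ .(mid ∷ʳ l)) (a∼f , w) odd shortest | mid ∷ʳ′ l
  with walk-split mid l [] w | f Fin.≟ l
... | _      , l∼a | no f≢l  = two≤deg G f≢l a∼f (adj-sym G l∼a)
... | cycle  , _   | yes refl = ⊥-elim (shortest mid shorter cycle (trans (cong parity length≡) odd))
  where
  length≡ : suc (length mid) ≡ length (mid ∷ʳ l)
  length≡ = trans (ℕ.+-comm 1 (length mid)) (≡.sym (List.length-++ mid))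
  shorter : length mid < length (f ∷ mid ∷ʳ l)
  shorter = s≤s (subst (length mid ≤_) length≡ (ℕ.n≤1+n _))

module MinimalOddClosedWalk {n} {G : Graph n} {a} {xs} (w : Walk G a xs a)
  (odd : parity (suc (length xs)) ≡ 1ℙ) (shortest : NoOddClosedWalkBelow G (length xs)) where

  odd-split : ∀ {b c} ys zs → Walk G b ys b → Walk G c zs c → length ys < length xs → length zs < length xs →
              parity (suc (length ys) + suc (length zs)) ≡ 1ℙ → ⊥
  odd-split ys zs w₁ w₂ ys< zs< odd-sum with parity (suc (length ys)) in e
  ... | 1ℙ = shortest ys ys< w₁ e
  ... | 0ℙ = shortest zs zs< w₂ (trans (cong (_⊕ parity (suc (length zs))) (≡.sym e))
                                      (trans (≡.sym (Parity.+-homo-+ (suc (length ys)) _)) odd-sum))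

  start-not-repeated : a ∉ xs
  start-not-repeated a∈xs with ∈-∃++ a∈xs
  ... | bs , cs , refl with walk-split bs a cs w
  ...   | w₁ , w₂ = odd-split bs cs w₁ w₂ bs< cs< (trans (cong parity lengths) odd)
    where
    lengths : suc (length bs) + suc (length cs) ≡ suc (length (bs ++ a ∷ cs))
    lengths = cong suc (≡.sym (List.length-++ bs))
    bs< : length bs < length (bs ++ a ∷ cs)
    bs< = subst (length bs <_) (≡.sym (List.length-++ bs)) (ℕ.m<m+n _ (s≤s z≤n))
    cs< : length cs < length (bs ++ a ∷ cs)
    cs< = subst (length cs <_) (≡.sym (List.length-++ bs)) (ℕ.m≤n+m _ _)

  no-chord : ∀ bs x c cs y ds → xs ≡ bs ++ x ∷ c ∷ cs ++ y ∷ ds → adj G x y ≡ true → ⊥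
  no-chord bs x c cs y ds refl x∼y with walk-split bs x (c ∷ cs ++ y ∷ ds) w
  ... | w₁ , x∼c , w₂ with walk-split cs y ds w₂ | chord-lengths bs x c cs y ds
  ...   | w₃ , w₄ | shorter₁ , shorter₂ , lengths =
    odd-split (c ∷ cs ++ y ∷ []) (bs ++ x ∷ y ∷ ds)
              (x∼c , walk-join cs y [] w₃ (adj-sym G x∼y)) (walk-join bs x (y ∷ ds) w₁ (x∼y , w₄))
              shorter₁ shorter₂ (trans (cong parity lengths) odd)

  two≤deg-on-walk : ∀ {u} → u ∈ a ∷ xs → 2 ≤ deg G u
  two≤deg-on-walk (here refl) = two≤deg-of-shortest xs w odd shortest
  two≤deg-on-walk (there u∈xs) with ∈-∃++ u∈xs
  ... | bs , cs , refl = two≤deg-of-shortest (cs ++ a ∷ bs) (walk-rotate bs _ cs w)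
                           (subst (λ k → parity (suc k) ≡ 1ℙ) length≡ odd)
                           (subst (NoOddClosedWalkBelow G) length≡ shortest)
    where
    length≡ : length (bs ++ _ ∷ cs) ≡ length (cs ++ a ∷ bs)
    length≡ = begin
      length (bs ++ _ ∷ cs)       ≡⟨ List.length-++ bs ⟩
      length bs + suc (length cs) ≡⟨ ℕ.+-suc (length bs) _ ⟩
      suc (length bs + length cs) ≡⟨ cong suc (ℕ.+-comm (length bs) _) ⟩
      suc (length cs + length bs) ≡⟨ ≡.sym (ℕ.+-suc (length cs) _) ⟩
      length cs + suc (length bs) ≡⟨ ≡.sym (List.length-++ cs) ⟩
      length (cs ++ a ∷ bs)       ∎
      where open ≡-Reasoning

module HamiltonianOddClosedWalk
  {m} {G H : Graph (suc m)} (D : DeckIncluded G H) (minDeg≡ : minDeg G ≡ minDeg H)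
  {a} {xs} (w : Walk G a xs a) (odd : parity (suc (length xs)) ≡ 1ℙ)
  (shortest : NoOddClosedWalkBelow G (length xs)) (spanning : ∀ v → v ∈ a ∷ xs)
  where

  open MinimalOddClosedWalk w odd shortest

  on-walk : ∀ {u} → u ≢ a → u ∈ xs
  on-walk {u} u≢a with spanning u
  ... | here u≡a   = ⊥-elim (u≢a u≡a)
  ... | there u∈xs = u∈xs

  2≤minDeg : 2 ≤ minDeg H
  2≤minDeg with minDeg-attained G
  ... | u , min≡ = subst (2 ≤_) (trans (≡.sym min≡) minDeg≡) (two≤deg-on-walk (spanning u))

  Endpoint : Fin (suc m) → Set
  Endpoint x = ∃ λ s → s ≢ a × ∀ {u} → adj G x u ≡ true → u ≢ a → u ≡ s

  first-endpoint : ∀ x₁ s rest → xs ≡ x₁ ∷ s ∷ rest → Endpoint x₁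
  first-endpoint x₁ s rest refl = s , (λ s≡a → start-not-repeated (there (here (≡.sym s≡a)))) , only-s
    where
    only-s : ∀ {u} → adj G x₁ u ≡ true → u ≢ a → u ≡ s
    only-s {u} x₁∼u u≢a with on-walk u≢a
    ... | here u≡x₁            = ⊥-elim (adj-irrefl G (subst (λ v → adj G x₁ v ≡ true) u≡x₁ x₁∼u))
    ... | there (here u≡s)     = u≡s
    ... | there (there u∈rest) with ∈-∃++ u∈rest
    ...   | cs , ds , refl = ⊥-elim (no-chord [] x₁ s cs u ds refl x₁∼u)

  last-endpoint : ∀ ys p xₗ → xs ≡ ys ++ p ∷ xₗ ∷ [] → Endpoint xₗ
  last-endpoint ys p xₗ refl = p , (λ p≡a → start-not-repeated (∈-++⁺ʳ ys (here (≡.sym p≡a)))) , only-p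
    where
    only-p : ∀ {u} → adj G xₗ u ≡ true → u ≢ a → u ≡ p
    only-p {u} xₗ∼u u≢a with ∈-++⁻ ys (on-walk u≢a)
    ... | inj₂ (here u≡p)          = u≡p
    ... | inj₂ (there (here u≡xₗ)) = ⊥-elim (adj-irrefl G (subst (λ v → adj G xₗ v ≡ true) u≡xₗ xₗ∼u))
    ... | inj₁ u∈ys with ∈-∃++ u∈ys
    ...   | bs , [] , refl =
      ⊥-elim (no-chord bs u p [] xₗ [] (List.++-assoc bs (u ∷ []) _) (adj-sym G xₗ∼u))
    ...   | bs , c ∷ cs , refl =
      ⊥-elim (no-chord bs u c (cs ++ p ∷ []) xₗ []
               (trans (List.++-assoc bs (u ∷ c ∷ cs) _)
                      (cong (λ t → bs ++ u ∷ c ∷ t) (≡.sym (List.++-assoc cs (p ∷ []) _))))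
               (adj-sym G xₗ∼u))

  module Path (x₁ : Fin (suc m)) (mid : List (Fin (suc m))) (xₗ : Fin (suc m))
              (xs≡ : xs ≡ x₁ ∷ mid ∷ʳ xₗ) where

    a∉ : a ∉ x₁ ∷ mid ∷ʳ xₗ
    a∉ = subst (a ∉_) xs≡ start-not-repeated

    a≢x₁ : a ≢ x₁
    a≢x₁ e = a∉ (here e)

    a≢xₗ : a ≢ xₗ
    a≢xₗ e = a∉ (there (∈-++⁺ʳ mid (here e)))

    a∉mid : a ∉ mid
    a∉mid a∈ = a∉ (there (∈-++⁺ˡ a∈))

    x₁-endpoint : Endpoint x₁
    x₁-endpoint with ∷ʳ-as-∷ mid xₗ
    ... | s , rest , eq = first-endpoint x₁ s rest (trans xs≡ (cong (x₁ ∷_) eq))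

    xₗ-endpoint : Endpoint xₗ
    xₗ-endpoint with ∷-as-∷ʳ x₁ mid
    ... | ys , p , eq =
      last-endpoint ys p xₗ (trans xs≡ (trans (cong (_∷ʳ xₗ) eq) (List.++-assoc ys (p ∷ []) _)))

    path : Walk G x₁ mid xₗ
    path = proj₁ (walk-split mid xₗ [] (proj₂ (subst (λ zs → Walk G a zs a) xs≡ w)))

    lowered : ∃ λ mid′ → map (punchIn a) mid′ ≡ mid ×
                         Walk (card G a) (punchOut a≢x₁) mid′ (punchOut a≢xₗ)
    lowered = walk-lower G a mid path a≢x₁ a∉mid a≢xₗ

    mid′ : List (Fin m)
    mid′ = proj₁ lowered

    b : Fin (suc m)
    b = proj₁ (D a)

    iso : card G a ≅ card H b
    iso = proj₂ (D a)

    φ : Fin m → Fin (suc m)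
    φ x = punchIn b (Inverse.to (proj₁ iso) x)

    adjacent-to-b : ∀ {x} (a≢x : a ≢ x) → Endpoint x → adj H b (φ (punchOut a≢x)) ≡ true
    adjacent-to-b a≢x (s , s≢a , only-s) = adj-sym H (adjacent-to-deleted H b _
      (subst (_≤ 1) (deg-≅ {G = card G a} {card H b} iso _) (deg-card≤1 G a a≢x s≢a only-s)) 2≤minDeg)

    odd-closed-walk-in-H : OddClosedWalk H
    odd-closed-walk-in-H = b , φ (punchOut a≢x₁) ∷ map φ mid′ ∷ʳ φ (punchOut a≢xₗ) , closed , odd′
      where
      closed : Walk H b (φ (punchOut a≢x₁) ∷ map φ mid′ ∷ʳ φ (punchOut a≢xₗ)) b
      closed = adjacent-to-b a≢x₁ x₁-endpoint ,
               walk-join (map φ mid′) _ []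
                 (walk-map φ (≅-card-homomorphism {G = G} {H} iso) mid′ (proj₂ (proj₂ lowered)))
                         (adj-sym H (adjacent-to-b a≢xₗ xₗ-endpoint))
      length≡ : length (map φ mid′ ∷ʳ φ (punchOut a≢xₗ)) ≡ length (mid ∷ʳ xₗ)
      length≡ = begin
        length (map φ mid′ ∷ʳ _)          ≡⟨ List.length-++ (map φ mid′) ⟩
        length (map φ mid′) + 1           ≡⟨ cong (_+ 1) (List.length-map φ mid′) ⟩
        length mid′ + 1                   ≡⟨ cong (_+ 1) (≡.sym (List.length-map (punchIn a) mid′)) ⟩
        length (map (punchIn a) mid′) + 1 ≡⟨ cong (λ zs → length zs + 1) (proj₁ (proj₂ lowered)) ⟩
        length mid + 1                    ≡⟨ ≡.sym (List.length-++ mid) ⟩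
        length (mid ∷ʳ xₗ)                ∎
        where open ≡-Reasoning
      odd′ : parity (suc (length (φ (punchOut a≢x₁) ∷ map φ mid′ ∷ʳ φ (punchOut a≢xₗ)))) ≡ 1ℙ
      odd′ = trans (cong (λ k → parity (suc (suc k))) length≡)
                   (subst (λ zs → parity (suc (length zs)) ≡ 1ℙ) xs≡ odd)

module _ {m} {G H : Graph (suc m)} (D : DeckIncluded G H) (minDeg≡ : minDeg G ≡ minDeg H)
         (H-bipartite : Bipartite H) where

  open import Data.List.Membership.DecPropositional (Fin._≟_ {suc m}) using (_∈?_)

  shortest-odd-closed-walk-⊥ : ∀ {a} xs → Walk G a xs a → parity (suc (length xs)) ≡ 1ℙ →
                               NoOddClosedWalkBelow G (length xs) → ⊥
  shortest-odd-closed-walk-⊥ [] a∼a _ _ = adj-irrefl G a∼a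
  shortest-odd-closed-walk-⊥ (x₁ ∷ tl) w odd shortest with initLast tl
  ... | [] with odd
  ...   | ()
  shortest-odd-closed-walk-⊥ {a} (x₁ ∷ .(mid ∷ʳ xₗ)) w odd shortest | mid ∷ʳ′ xₗ
    with all? (λ v → v ∈? a ∷ x₁ ∷ mid ∷ʳ xₗ)
  ... | yes spanning = bipartite-¬OddClosedWalk {G = H} H-bipartite
          (HamiltonianOddClosedWalk.Path.odd-closed-walk-in-H D minDeg≡ w odd shortest spanning
            x₁ mid xₗ refl)
  ... | no ¬spanning with ¬∀⟶∃¬ _ _ (λ v → v ∈? a ∷ x₁ ∷ mid ∷ʳ xₗ) ¬spanning
  ...   | v , v∉ = bipartite-¬OddClosedWalk {G = H} H-bipartite (OddClosedWalk-transfer D _ w odd v v∉)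

  no-odd-closed-walk : ∀ N {a} xs → length xs < N → Walk G a xs a → parity (suc (length xs)) ≢ 1ℙ
  no-odd-closed-walk (suc N) xs (s≤s xs≤N) w odd =
    shortest-odd-closed-walk-⊥ xs w odd (λ ys ys<xs → no-odd-closed-walk N ys (ℕ.≤-trans ys<xs xs≤N))

  Bipartite-transfer : Bipartite G
  Bipartite-transfer with bipartition-or-odd _ G
  ... | inj₁ B          = Bipartition→Bipartite B
  ... | inj₂ (_ , odd) with oddParityWalk→OddClosedWalk odd
  ...   | _ , xs , w , odd′ = ⊥-elim (no-odd-closed-walk (suc (length xs)) xs ℕ.≤-refl w odd′)

lemma2 : (m : ℕ) → 3 ≤ m → (G₁ G₂ : Graph (suc m)) → SameReducedDeck G₁ G₂ →
           ((minDeg G₁ ≡ minDeg G₂) × (maxDeg G₁ ≡ maxDeg G₂))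
           × ((k : ℕ) → 3 ≤ k → k < suc m → (HasCycle G₁ k ⇔ HasCycle G₂ k))
           × (Bipartite G₁ ⇔ Bipartite G₂)
lemma2 (suc (suc (suc j))) (s≤s (s≤s (s≤s z≤n))) G₁ G₂ deck@(D₁₂ , D₂₁) =
  (minDeg≡ , maxDeg-≡ G₁ G₂ deck) ,
  (λ k _ k<n → mk⇔ (HasCycle-transfer {G = G₁} {G₂} D₁₂ k<n)
                   (HasCycle-transfer {G = G₂} {G₁} D₂₁ k<n)) ,
  mk⇔ (Bipartite-transfer {G = G₂} {G₁} D₂₁ (≡.sym minDeg≡))
      (Bipartite-transfer {G = G₁} {G₂} D₁₂ minDeg≡)
  where
  minDeg≡ : minDeg G₁ ≡ minDeg G₂
  minDeg≡ = minDeg-≡ G₁ G₂ deck
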